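{- Let $V\subset\mathbb{R}^d$ be a finite antichain and $p\in S_V$. If $p$ is a syzygy-point, then $p$ is a characteristic point of $S_V$.
   Context: $\mathbb{R}^d$ carries the dominance order ($x\le y$ iff $x_k\le y_k$ for all $k$). Write $x\rhd y$ if $x_k>y_k$ for all $k$, and $x\rhd_i y$ if $x_i=y_i$ and $x_j>y_j$ for all $j\neq i$. For a finite antichain $V$, $S_V$ is the topological boundary of $\{x: x\ge v\text{ for some }v\in V\}$; equivalently $p\in S_V$ iff $p\ge v$ for some $v\in V$ and no $w\in V$ satisfies $p\rhd w$. Flats: for $v\in V$, $U_i(v)=\{p\in S_V: p\rhd_i v\}$; $v\sim_i w$ iff $U_i(v)\cap U_i(w)\ne\emptyset$; $\sim_i^c$ is the reflexive–transitive closure; the $i$-flat $F_i(v)$ is the closure of $\bigcup_{w\sim_i^c v}U_i(w)$. A point $p\in S_V$ is characteristic if for every $i\in\{1,\dots,d\}$ it lies in some $i$-flat. For $p\in S_V$, $\Delta_p$ is the simplicial complex on $\{1,\dots,d\}$ with $I\in\Delta_p$ iff $p+\epsilon\sum_{i\in I}e_i\in S_V$ for some $\epsilon>0$ ($e_i$ the standard basis vectors). $p$ is a syzygy-point if $\Delta_p$ has non-trivial reduced homology. -}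

module Defs where

open import Level using (0ℓ) renaming (suc to lsuc)
open import Data.Nat as ℕ using (ℕ; zero; suc)
open import Data.Integer as ℤ using (ℤ)
open import Data.Bool using (Bool; true; false; if_then_else_; _∧_)
open import Data.Fin using (Fin; toℕ)
open import Data.Fin.Subset using (Subset; inside; ∣_∣)
open import Data.Vec using (lookup; _[_]≔_)
open import Data.List using (List; map; foldr; allFin)
open import Data.List.Membership.Propositional using (_∈_)
open import Data.Product using (Σ; ∃; ∃-syntax; _×_; _,_)
open import Data.Sum using (_⊎_)
open import Relation.Nullary using (¬_)
open import Relation.Binary.PropositionalEquality using (_≡_)
open import Relation.Binary.Construct.Closure.ReflexiveTransitive using (Star)
open import Algebra.Structures using (IsCommutativeRing)
open import Relation.Binary.Structures using (IsStrictTotalOrder)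

-- The real numbers, axiomatised as a Dedekind-complete ordered field.
-- (Every model is isomorphic to ℝ; the theorem quantifies over all.)

record CompleteOrderedField : Set₁ where
  infixl 6 _+_
  infixl 7 _*_
  infix  8 -_
  infix  4 _<_ _≤_
  field
    Carrier : Set
    _+_ _*_ : Carrier → Carrier → Carrier
    -_      : Carrier → Carrier
    0# 1#   : Carrier
    _<_     : Carrier → Carrier → Set
    isCommutativeRing  : IsCommutativeRing _≡_ _+_ _*_ -_ 0# 1#
    0≢1                : ¬ (0# ≡ 1#)
    inverse            : ∀ x → ¬ (x ≡ 0#) → ∃[ y ] (x * y ≡ 1#)
    isStrictTotalOrder : IsStrictTotalOrder _≡_ _<_
    +-mono-<           : ∀ {x y} z → x < y → x + z < y + z
    *-pos              : ∀ {x y} → 0# < x → 0# < y → 0# < x * y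

  _≤_ : Carrier → Carrier → Set
  x ≤ y = (x < y) ⊎ (x ≡ y)

  field
    lub : (P : Carrier → Set) → ∃ P → (∃[ b ] (∀ x → P x → x ≤ b)) →
          ∃[ s ] ((∀ x → P x → x ≤ s) ×
                  (∀ b → (∀ x → P x → x ≤ b) → s ≤ b))

module _ (R : CompleteOrderedField) {d : ℕ} where
  open CompleteOrderedField R

  Point : Set
  Point = Fin d → Carrier

  _≼_ : Point → Point → Set
  x ≼ y = ∀ k → x k ≤ y k

  _⊳_ : Point → Point → Set
  x ⊳ y = ∀ k → y k < x k

  _⊳[_]_ : Point → Fin d → Point → Set
  x ⊳[ i ] y = (x i ≡ y i) × (∀ j → ¬ (j ≡ i) → y j < x j)

  Antichain : List Point → Set
  Antichain V = ∀ {v w} → v ∈ V → w ∈ V → v ≼ w → ∀ k → v k ≡ w k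

  InS : List Point → Point → Set
  InS V p = (∃[ v ] (v ∈ V × v ≼ p)) × (∀ w → w ∈ V → ¬ (p ⊳ w))

  InU : List Point → Fin d → Point → Point → Set
  InU V i v p = InS V p × (p ⊳[ i ] v)

  Sim : List Point → Fin d → Point → Point → Set
  Sim V i v w = v ∈ V × w ∈ V × ∃[ p ] (InU V i v p × InU V i w p)

  InClosure : (Point → Set) → Point → Set
  InClosure A p = ∀ ε → 0# < ε →
    ∃[ q ] (A q × (∀ k → (p k + - ε < q k) × (q k < p k + ε)))

  InFlat : List Point → Fin d → Point → Point → Set
  InFlat V i v = InClosure (λ q → ∃[ w ] (Star (Sim V i) v w × InU V i w q))

  Characteristic : List Point → Point → Set
  Characteristic V p = InS V p × (∀ i → ∃[ v ] (v ∈ V × InFlat V i v p))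

  shift : Point → Subset d → Carrier → Point
  shift p I ε k = if lookup I k then p k + ε else p k

  InΔ : List Point → Point → Subset d → Set
  InΔ V p I = ∃[ ε ] (0# < ε × InS V (shift p I ε))

  -- Simplicial chains of Δ_p with ℤ coefficients (reduced: the empty
  -- face is the unique face of size 0, living in degree -1).  A chain
  -- of "size k" (degree k-1) is a function on subsets supported on
  -- faces of Δ_p of cardinality k.

  sumFin : (Fin d → ℤ) → ℤ
  sumFin f = foldr ℤ._+_ (ℤ.+ 0) (map f (allFin d))

  countBelow : Subset d → Fin d → ℕ
  countBelow J i = foldr ℕ._+_ 0
    (map (λ j → if lookup J j ∧ (toℕ j ℕ.<ᵇ toℕ i) then 1 else 0) (allFin d))

  sign : ℕ → ℤ
  sign zero = ℤ.+ 1
  sign (suc zero) = ℤ.- (ℤ.+ 1)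
  sign (suc (suc n)) = sign n

  ∂ : (Subset d → ℤ) → Subset d → ℤ
  ∂ c J = sumFin (λ i → if lookup J i then ℤ.+ 0
                         else sign (countBelow J i) ℤ.* c (J [ i ]≔ inside))

  Chain : List Point → Point → ℕ → (Subset d → ℤ) → Set
  Chain V p k c = ∀ J → ¬ (c J ≡ ℤ.+ 0) → InΔ V p J × ∣ J ∣ ≡ k

  Cycle : List Point → Point → ℕ → (Subset d → ℤ) → Set
  Cycle V p k c = Chain V p k c × (∀ J → suc ∣ J ∣ ≡ k → ∂ c J ≡ ℤ.+ 0)

  Boundary : List Point → Point → ℕ → (Subset d → ℤ) → Set
  Boundary V p k c = ∃[ b ] (Chain V p (suc k) b × (∀ J → ∣ J ∣ ≡ k → ∂ b J ≡ c J))

  NontrivialHomologyAt : List Point → Point → ℕ → Set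
  NontrivialHomologyAt V p k = ∃[ c ] (Cycle V p k c × ¬ Boundary V p k c)

  SyzygyPoint : List Point → Point → Set
  SyzygyPoint V p = ∃[ k ] NontrivialHomologyAt V p k

{-# OPTIONS --safe #-}
-- Call a set I of coordinates blocked when some generator w ≤ p lies strictly below p in
-- every coordinate outside I; for p ∈ S_V, I ∈ Δ_p exactly when I is not blocked.
-- Fix a direction i. If some generator w ≤ p with wᵢ = pᵢ has an unblocked set of tight
-- coordinates {k ≠ i | w_k = p_k}, raising p by a small δ in those coordinates stays in
-- S_V and lands in U_i(w), so p ∈ F_i(w). Otherwise Δ_p is a cone with apex i, since a
-- generator blocking I ∪ {i} but not I would be such a w. On chains the cone operator
-- satisfies ∂(i * c) + i * ∂c = c, so every reduced cycle of a cone bounds, and Δ_p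
-- has trivial reduced homology.
module Submission where

open import Defs
open import Level using (0ℓ)
open import Function using (_∘_; _∘′_)
open import Data.Nat as ℕ using (ℕ; zero; suc; _<ᵇ_)
import Data.Nat.Properties as ℕ
open import Data.Integer as ℤ using (ℤ; +_)
import Data.Integer.Properties as ℤ
open import Data.Integer.Tactic.RingSolver using (solve-∀)
open import Data.Bool using (Bool; true; false; if_then_else_; T; not; _∧_)
open import Data.Bool.Properties using (∧-zeroʳ)
open import Data.Fin using (Fin; toℕ)
import Data.Fin.Properties as Fin
open import Data.Fin.Subset using (Subset; inside; outside; ∣_∣)
open import Data.Vec using (_∷_; lookup; _[_]≔_)
open import Data.Vec.Properties using (lookup∘update; lookup∘update′; []≔-idempotent; []≔-commutes; []≔-lookup)
open import Data.Vec.Functional using (Vector; removeAt)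
open import Data.List using (List; []; _∷_; foldr; map; allFin; tabulate)
open import Data.List.Properties using (map-tabulate)
open import Data.List.Membership.Propositional using (_∈_; find; lose)
open import Data.List.Membership.Propositional.Properties using (∈-allFin)
open import Data.List.Relation.Unary.Any using (here; there; any?)
open import Data.Product using (∃-syntax; _×_; _,_; proj₁; proj₂)
open import Data.Sum as Sum using (_⊎_; inj₁; inj₂; [_,_]′)
open import Data.Empty using (⊥-elim)
open import Relation.Nullary using (¬_; Dec; yes; no; ¬?)
open import Relation.Nullary.Decidable using (_×-dec_; _⊎-dec_; map′; isYes; toWitness; fromWitness; fromWitnessFalse)
open import Relation.Binary.PropositionalEquality
  using (_≡_; refl; sym; trans; cong; cong₂; subst; subst₂; module ≡-Reasoning)
open import Relation.Binary.Definitions using (tri<; tri≈; tri>)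
open import Relation.Binary.Structures using (IsStrictTotalOrder)
import Relation.Binary.Construct.Closure.ReflexiveTransitive as Star
open import Algebra.Structures using (IsCommutativeRing)
open import Algebra.Bundles using (CommutativeMonoid; Ring)
import Algebra.Properties.Ring as RingProperties

module OrderedFieldProperties (R : CompleteOrderedField) where
  open CompleteOrderedField R
  open IsCommutativeRing isCommutativeRing
    using (+-comm; +-assoc; +-identityˡ; +-identityʳ; -‿inverseˡ; -‿inverseʳ; *-identityˡ; distribʳ;
           *-identityʳ; distribˡ; zeroʳ; isRing)
  open IsStrictTotalOrder isStrictTotalOrder using (compare; irrefl) renaming (trans to <-trans)

  private
    ring : Ring 0ℓ 0ℓ
    ring = record { isRing = isRing }

  open RingProperties ring using (-‿distribʳ-*; -1*x≈-x; -‿involutive; xyx⁻¹≈y)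

  <-irrefl : ∀ {x} → ¬ x < x
  <-irrefl = irrefl refl

  <-asym : ∀ {x y} → x < y → ¬ y < x
  <-asym x<y y<x = <-irrefl (<-trans x<y y<x)

  <-≤-trans : ∀ {x y z} → x < y → y ≤ z → x < z
  <-≤-trans x<y (inj₁ y<z) = <-trans x<y y<z
  <-≤-trans x<y (inj₂ refl) = x<y

  ≤-<-trans : ∀ {x y z} → x ≤ y → y < z → x < z
  ≤-<-trans (inj₁ x<y) y<z = <-trans x<y y<z
  ≤-<-trans (inj₂ refl) y<z = y<z

  ≤-trans : ∀ {x y z} → x ≤ y → y ≤ z → x ≤ z
  ≤-trans (inj₁ x<y) y≤z = inj₁ (<-≤-trans x<y y≤z)
  ≤-trans (inj₂ refl) y≤z = y≤z

  ≤-refl : ∀ {x} → x ≤ x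
  ≤-refl = inj₂ refl

  <⇒≱ : ∀ {x y} → x < y → ¬ y ≤ x
  <⇒≱ x<y y≤x = <-irrefl (<-≤-trans x<y y≤x)

  ≮⇒≥ : ∀ {x y} → ¬ x < y → y ≤ x
  ≮⇒≥ {x} {y} x≮y with compare x y
  ... | tri< x<y _ _ = ⊥-elim (x≮y x<y)
  ... | tri≈ _ x≡y _ = inj₂ (sym x≡y)
  ... | tri> _ _ y<x = inj₁ y<x

  +-monoʳ-< : ∀ {x y} z → x < y → z + x < z + y
  +-monoʳ-< {x} {y} z x<y = subst₂ _<_ (+-comm x z) (+-comm y z) (+-mono-< z x<y)

  +-monoʳ-≤ : ∀ {x y} z → x ≤ y → z + x ≤ z + y
  +-monoʳ-≤ z (inj₁ x<y) = inj₁ (+-monoʳ-< z x<y)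
  +-monoʳ-≤ z (inj₂ refl) = ≤-refl

  x+[y-x]≡y : ∀ x y → x + (y + - x) ≡ y
  x+[y-x]≡y x y = trans (sym (+-assoc x y (- x))) (xyx⁻¹≈y x y)

  x<x+ε : ∀ x {ε} → 0# < ε → x < x + ε
  x<x+ε x {ε} 0<ε = subst (_< x + ε) (+-identityʳ x) (+-monoʳ-< x 0<ε)

  x-ε<x : ∀ x {ε} → 0# < ε → x + - ε < x
  x-ε<x x {ε} 0<ε = subst₂ _<_ (+-identityˡ (x + - ε)) (x+[y-x]≡y ε x) (+-mono-< (x + - ε) 0<ε)

  x<y⇒0<y-x : ∀ {x y} → x < y → 0# < y + - x
  x<y⇒0<y-x {x} {y} x<y = subst (_< y + - x) (-‿inverseʳ x) (+-mono-< (- x) x<y)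

  x<0⇒0<-x : ∀ {x} → x < 0# → 0# < - x
  x<0⇒0<-x {x} x<0 = subst₂ _<_ (-‿inverseʳ x) (+-identityˡ (- x)) (+-mono-< (- x) x<0)

  0<1 : 0# < 1#
  0<1 with compare 0# 1#
  ... | tri< 0<1 _ _ = 0<1
  ... | tri≈ _ 0≡1 _ = ⊥-elim (0≢1 0≡1)
  ... | tri> _ _ 1<0 = ⊥-elim (<-asym 1<0 (subst (0# <_) [-1][-1]≡1 (*-pos 0<-1 0<-1)))
    where
    0<-1 : 0# < - 1#
    0<-1 = x<0⇒0<-x 1<0
    [-1][-1]≡1 : - 1# * - 1# ≡ 1#
    [-1][-1]≡1 = trans (-1*x≈-x (- 1#)) (-‿involutive 1#)

  0≮-1 : ¬ 0# < - 1#
  0≮-1 0<-1 = <-asym 0<1 (subst₂ _<_ (+-identityˡ 1#) (-‿inverseˡ 1#) (+-mono-< 1# 0<-1))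

  inverse-positive : ∀ {x y} → 0# < x → x * y ≡ 1# → 0# < y
  inverse-positive {x} {y} 0<x xy≡1 with compare 0# y
  ... | tri< 0<y _ _ = 0<y
  ... | tri≈ _ refl _ = ⊥-elim (0≢1 (trans (sym (zeroʳ x)) xy≡1))
  ... | tri> _ _ y<0 = ⊥-elim (0≮-1 (subst (0# <_) x[-y]≡-1 (*-pos 0<x (x<0⇒0<-x y<0))))
    where
    x[-y]≡-1 : x * - y ≡ - 1#
    x[-y]≡-1 = trans (sym (-‿distribʳ-* x y)) (cong -_ xy≡1)

  0<2 : 0# < 1# + 1#
  0<2 = <-trans 0<1 (x<x+ε 1# 0<1)

  ∃-between-0-and : ∀ {ε} → 0# < ε → ∃[ δ ] (0# < δ × δ < ε)
  ∃-between-0-and {ε} 0<ε with inverse (1# + 1#) (λ 2≡0 → <-irrefl (subst (0# <_) 2≡0 0<2))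
  ... | h , 2h≡1 = ε * h , 0<εh , εh<ε
    where
    0<εh : 0# < ε * h
    0<εh = *-pos 0<ε (inverse-positive 0<2 2h≡1)
    εh+εh≡ε : ε * h + ε * h ≡ ε
    εh+εh≡ε = begin
      ε * h + ε * h          ≡⟨ distribˡ ε h h ⟨
      ε * (h + h)            ≡⟨ cong (ε *_) (cong₂ _+_ (*-identityˡ h) (*-identityˡ h)) ⟨
      ε * (1# * h + 1# * h)  ≡⟨ cong (ε *_) (distribʳ h 1# 1#) ⟨
      ε * ((1# + 1#) * h)    ≡⟨ cong (ε *_) 2h≡1 ⟩
      ε * 1#                 ≡⟨ *-identityʳ ε ⟩
      ε                      ∎
      where open ≡-Reasoning
    εh<ε : ε * h < ε
    εh<ε = subst₂ _<_ (+-identityʳ (ε * h)) εh+εh≡ε (+-monoʳ-< (ε * h) 0<εh)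

  Eventually : (Carrier → Set) → Set
  Eventually P = ∃[ δ₀ ] (0# < δ₀ × ∀ {δ} → 0# < δ → δ ≤ δ₀ → P δ)

  eventually-witness : ∀ {P} → Eventually P → ∃[ δ ] (0# < δ × P δ)
  eventually-witness (δ₀ , 0<δ₀ , P) = δ₀ , 0<δ₀ , P 0<δ₀ ≤-refl

  eventually-× : ∀ {P Q} → Eventually P → Eventually Q → Eventually (λ δ → P δ × Q δ)
  eventually-× (a , 0<a , P) (b , 0<b , Q) with compare a b
  ... | tri< a<b _ _ = a , 0<a , λ 0<δ δ≤a → P 0<δ δ≤a , Q 0<δ (≤-trans δ≤a (inj₁ a<b))
  ... | tri≈ _ refl _ = a , 0<a , λ 0<δ δ≤a → P 0<δ δ≤a , Q 0<δ δ≤a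
  ... | tri> _ _ b<a = b , 0<b , λ 0<δ δ≤b → P 0<δ (≤-trans δ≤b (inj₁ b<a)) , Q 0<δ δ≤b

  eventually-∀∈ : ∀ {A : Set} {P : A → Carrier → Set} (xs : List A) →
                  (∀ x → Eventually (P x)) → Eventually (λ δ → ∀ x → x ∈ xs → P x δ)
  eventually-∀∈ [] _ = 1# , 0<1 , λ _ _ _ ()
  eventually-∀∈ (y ∷ xs) P-ev with eventually-× (P-ev y) (eventually-∀∈ xs P-ev)
  ... | δ₀ , 0<δ₀ , P = δ₀ , 0<δ₀ , λ 0<δ δ≤δ₀ → λ where
    x (here refl) → proj₁ (P 0<δ δ≤δ₀)
    x (there x∈xs) → proj₂ (P 0<δ δ≤δ₀) x x∈xs

  eventually-∀ : ∀ {n} {P : Fin n → Carrier → Set} →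
                 (∀ k → Eventually (P k)) → Eventually (λ δ → ∀ k → P k δ)
  eventually-∀ {n} P-ev =
    let δ₀ , 0<δ₀ , P = eventually-∀∈ (allFin n) P-ev
    in δ₀ , 0<δ₀ , λ 0<δ δ≤δ₀ k → P 0<δ δ≤δ₀ k (∈-allFin k)

  eventually-< : ∀ {ε} → 0# < ε → Eventually (_< ε)
  eventually-< 0<ε with ∃-between-0-and 0<ε
  ... | δ₀ , 0<δ₀ , δ₀<ε = δ₀ , 0<δ₀ , λ _ δ≤δ₀ → ≤-<-trans δ≤δ₀ δ₀<ε

  eventually-below-gap : ∀ x y → Eventually (λ δ → x < y → x + δ ≤ y)
  eventually-below-gap x y with compare x y
  ... | tri< x<y _ _ = y + - x , x<y⇒0<y-x x<y ,
        λ _ δ≤gap _ → subst (x + _ ≤_) (x+[y-x]≡y x y) (+-monoʳ-≤ x δ≤gap)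
  ... | tri≈ x≮y _ _ = 1# , 0<1 , λ _ _ x<y → ⊥-elim (x≮y x<y)
  ... | tri> x≮y _ _ = 1# , 0<1 , λ _ _ x<y → ⊥-elim (x≮y x<y)

module FiniteSums (M : CommutativeMonoid 0ℓ 0ℓ) where
  open CommutativeMonoid M using (Carrier; _≈_; _∙_; ε; ∙-congˡ; ∙-congʳ; identityˡ; identityʳ; setoid)
    renaming (refl to ≈-refl; sym to ≈-sym)
  open import Algebra.Properties.CommutativeMonoid.Sum M public
  open import Relation.Binary.Reasoning.Setoid setoid

  foldr-map-allFin : ∀ n (f : Vector Carrier n) → foldr _∙_ ε (map f (allFin n)) ≡ sum f
  foldr-map-allFin n f = trans (cong (foldr _∙_ ε) (map-tabulate (λ k → k) f)) (foldr-tabulate n f)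
    where
    foldr-tabulate : ∀ n (f : Vector Carrier n) → foldr _∙_ ε (tabulate f) ≡ sum f
    foldr-tabulate zero f = refl
    foldr-tabulate (suc n) f = cong (f Fin.zero ∙_) (foldr-tabulate n (f ∘ Fin.suc))

  sum-agree-off : ∀ {n} (f g : Vector Carrier n) l → (∀ j → ¬ j ≡ l → f j ≈ g j) → f l ≈ ε →
                  sum g ≈ g l ∙ sum f
  sum-agree-off {suc n} f g l f≈g fₗ≈ε = begin
    sum g                             ≈⟨ sum-remove g ⟩
    g l ∙ sum (removeAt g l)          ≈⟨ ∙-congˡ (sum-cong-≋ (λ j → ≈-sym (f≈g _ (Fin.punchInᵢ≢i l j)))) ⟩
    g l ∙ sum (removeAt f l)          ≈⟨ ∙-congˡ (identityˡ _) ⟨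
    g l ∙ (ε ∙ sum (removeAt f l))    ≈⟨ ∙-congˡ (∙-congʳ fₗ≈ε) ⟨
    g l ∙ (f l ∙ sum (removeAt f l))  ≈⟨ ∙-congˡ (sum-remove f) ⟨
    g l ∙ sum f                       ∎

  sum-single : ∀ {n} (f : Vector Carrier n) l → (∀ j → ¬ j ≡ l → f j ≈ ε) → sum f ≈ f l
  sum-single {n} f l off-l = begin
    sum f                    ≈⟨ sum-agree-off (λ _ → ε) f l (λ j j≢l → ≈-sym (off-l j j≢l)) ≈-refl ⟩
    f l ∙ sum {n} (λ _ → ε)  ≈⟨ ∙-congˡ (sum-replicate-zero n) ⟩
    f l ∙ ε                  ≈⟨ identityʳ (f l) ⟩
    f l                      ∎

module SimplicialCone (R : CompleteOrderedField) {d : ℕ} where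
  private
    module ℕΣ = FiniteSums ℕ.+-0-commutativeMonoid
    module ℤΣ = FiniteSums ℤ.+-0-commutativeMonoid
  open import Algebra.Properties.Semiring.Sum ℤ.+-*-semiring using (*-distribˡ-sum)

  sg : ℕ → ℤ
  sg = sign R {d}

  sign-suc : ∀ m → sg (suc m) ≡ ℤ.- sg m
  sign-suc zero = refl
  sign-suc (suc zero) = refl
  sign-suc (suc (suc m)) = sign-suc m

  sign-+ : ∀ m n → sg (m ℕ.+ n) ≡ sg m ℤ.* sg n
  sign-+ zero n = sym (ℤ.*-identityˡ (sg n))
  sign-+ (suc m) n = begin
    sg (suc (m ℕ.+ n))         ≡⟨ sign-suc (m ℕ.+ n) ⟩
    ℤ.- sg (m ℕ.+ n)           ≡⟨ cong ℤ.-_ (sign-+ m n) ⟩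
    ℤ.- (sg m ℤ.* sg n)        ≡⟨ ℤ.neg-distribˡ-* (sg m) (sg n) ⟩
    ℤ.- sg m ℤ.* sg n          ≡⟨ cong (ℤ._* sg n) (sign-suc m) ⟨
    sg (suc m) ℤ.* sg n        ∎
    where open ≡-Reasoning

  sign-cancel : ∀ m x → sg m ℤ.* (sg m ℤ.* x) ≡ x
  sign-cancel m x = trans (sym (ℤ.*-assoc (sg m) (sg m) x)) (trans (cong (ℤ._* x) (sq m)) (ℤ.*-identityˡ x))
    where
    sq : ∀ m → sg m ℤ.* sg m ≡ + 1
    sq zero = refl
    sq (suc zero) = refl
    sq (suc (suc m)) = sq m

  sign-opposite : ∀ x y a b X → x ℕ.+ y ≡ 1 →
    sg (x ℕ.+ a) ℤ.* (sg (y ℕ.+ b) ℤ.* X) ℤ.+ sg b ℤ.* (sg a ℤ.* X) ≡ + 0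
  sign-opposite x y a b X x+y≡1 = begin
    sg (x ℕ.+ a) ℤ.* (sg (y ℕ.+ b) ℤ.* X) ℤ.+ sg b ℤ.* (sg a ℤ.* X)
      ≡⟨ cong₂ (λ u v → u ℤ.* (v ℤ.* X) ℤ.+ sg b ℤ.* (sg a ℤ.* X)) (sign-+ x a) (sign-+ y b) ⟩
    sg x ℤ.* sg a ℤ.* (sg y ℤ.* sg b ℤ.* X) ℤ.+ sg b ℤ.* (sg a ℤ.* X)
      ≡⟨ regroup (sg x) (sg y) (sg a) (sg b) X ⟩
    (sg x ℤ.* sg y ℤ.+ + 1) ℤ.* (sg a ℤ.* sg b ℤ.* X)
      ≡⟨ cong (λ s → (s ℤ.+ + 1) ℤ.* (sg a ℤ.* sg b ℤ.* X)) (trans (sym (sign-+ x y)) (cong sg x+y≡1)) ⟩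
    + 0 ℤ.* (sg a ℤ.* sg b ℤ.* X)
      ≡⟨ ℤ.*-zeroˡ (sg a ℤ.* sg b ℤ.* X) ⟩
    + 0 ∎
    where
    open ≡-Reasoning
    regroup : ∀ u v s t X →
      u ℤ.* s ℤ.* (v ℤ.* t ℤ.* X) ℤ.+ t ℤ.* (s ℤ.* X) ≡ (u ℤ.* v ℤ.+ + 1) ℤ.* (s ℤ.* t ℤ.* X)
    regroup = solve-∀

  precedes : Fin d → Fin d → ℕ
  precedes j i = if toℕ j <ᵇ toℕ i then 1 else 0

  precedes-total : ∀ {i j} → ¬ i ≡ j → precedes i j ℕ.+ precedes j i ≡ 1
  precedes-total {i} {j} i≢j = go (toℕ i) (toℕ j) (i≢j ∘′ Fin.toℕ-injective)
    where
    go : ∀ m n → ¬ m ≡ n → (if m <ᵇ n then 1 else 0) ℕ.+ (if n <ᵇ m then 1 else 0) ≡ 1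
    go zero zero m≢n = ⊥-elim (m≢n refl)
    go zero (suc n) _ = refl
    go (suc m) zero _ = refl
    go (suc m) (suc n) m≢n = go m n (m≢n ∘′ cong suc)

  counted : Subset d → Fin d → Fin d → ℕ
  counted J i j = if lookup J j ∧ (toℕ j <ᵇ toℕ i) then 1 else 0

  countBelow≡sum : ∀ J i → countBelow R J i ≡ ℕΣ.sum (counted J i)
  countBelow≡sum J i = ℕΣ.foldr-map-allFin d (counted J i)

  countBelow-update-self : ∀ J i x → countBelow R (J [ i ]≔ x) i ≡ countBelow R J i
  countBelow-update-self J i x = begin
    countBelow R (J [ i ]≔ x) i       ≡⟨ countBelow≡sum (J [ i ]≔ x) i ⟩
    ℕΣ.sum (counted (J [ i ]≔ x) i)   ≡⟨ ℕΣ.sum-cong-≗ same-count ⟩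
    ℕΣ.sum (counted J i)              ≡⟨ countBelow≡sum J i ⟨
    countBelow R J i                  ∎
    where
    open ≡-Reasoning
    n<ᵇn≡false : ∀ n → (n <ᵇ n) ≡ false
    n<ᵇn≡false zero = refl
    n<ᵇn≡false (suc n) = n<ᵇn≡false n
    same-count : ∀ j → counted (J [ i ]≔ x) i j ≡ counted J i j
    same-count j with j Fin.≟ i
    ... | yes refl rewrite n<ᵇn≡false (toℕ j) | ∧-zeroʳ (lookup (J [ j ]≔ x) j) | ∧-zeroʳ (lookup J j) = refl
    ... | no j≢i rewrite lookup∘update′ j≢i J x = refl

  countBelow-insert : ∀ J l i → lookup J l ≡ false →
    countBelow R (J [ l ]≔ inside) i ≡ precedes l i ℕ.+ countBelow R J i
  countBelow-insert J l i l∉J = begin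
    countBelow R (J [ l ]≔ inside) i                        ≡⟨ countBelow≡sum (J [ l ]≔ inside) i ⟩
    ℕΣ.sum (counted (J [ l ]≔ inside) i)                    ≡⟨ ℕΣ.sum-agree-off (counted J i) _ l same-off-l zero-at-l ⟩
    counted (J [ l ]≔ inside) i l ℕ.+ ℕΣ.sum (counted J i)   ≡⟨ cong₂ ℕ._+_ inserted-at-l (sym (countBelow≡sum J i)) ⟩
    precedes l i ℕ.+ countBelow R J i                       ∎
    where
    open ≡-Reasoning
    same-off-l : ∀ j → ¬ j ≡ l → counted J i j ≡ counted (J [ l ]≔ inside) i j
    same-off-l j j≢l rewrite lookup∘update′ j≢l J inside = refl
    zero-at-l : counted J i l ≡ 0
    zero-at-l rewrite l∉J = refl
    inserted-at-l : counted (J [ l ]≔ inside) i l ≡ precedes l i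
    inserted-at-l rewrite lookup∘update l J inside = refl

  update-restore : ∀ (J : Subset d) i {x y} → lookup J i ≡ x → (J [ i ]≔ y) [ i ]≔ x ≡ J
  update-restore J i Jᵢ≡x = trans ([]≔-idempotent J i) (trans (cong (J [ i ]≔_) (sym Jᵢ≡x)) ([]≔-lookup J i))

  cone : Fin d → (Subset d → ℤ) → Subset d → ℤ
  cone i c K = if lookup K i then sg (countBelow R K i) ℤ.* c (K [ i ]≔ outside) else + 0

  ∂-summand : (Subset d → ℤ) → Subset d → Fin d → ℤ
  ∂-summand c J l = if lookup J l then + 0 else sg (countBelow R J l) ℤ.* c (J [ l ]≔ inside)

  ∂≡sum : ∀ c J → ∂ R c J ≡ ℤΣ.sum (∂-summand c J)
  ∂≡sum c J = ℤΣ.foldr-map-allFin d (∂-summand c J)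

  summand-inside : ∀ c J l → lookup J l ≡ true → ∂-summand c J l ≡ + 0
  summand-inside c J l l∈J rewrite l∈J = refl

  summand-outside : ∀ c J l → lookup J l ≡ false →
    ∂-summand c J l ≡ sg (countBelow R J l) ℤ.* c (J [ l ]≔ inside)
  summand-outside c J l l∉J rewrite l∉J = refl

  cone-inside : ∀ i c K → lookup K i ≡ true → cone i c K ≡ sg (countBelow R K i) ℤ.* c (K [ i ]≔ outside)
  cone-inside i c K i∈K rewrite i∈K = refl

  cone-outside : ∀ i c K → lookup K i ≡ false → cone i c K ≡ + 0
  cone-outside i c K i∉K rewrite i∉K = refl

  module _ (i : Fin d) (c : Subset d → ℤ) where

    ∂-cone-off-apex : ∀ J → lookup J i ≡ false → ∂ R (cone i c) J ≡ c J
    ∂-cone-off-apex J i∉J = trans (∂≡sum (cone i c) J) (trans (ℤΣ.sum-single _ i vanishes-off-i) apex-term)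
      where
      open ≡-Reasoning
      vanishes-off-i : ∀ l → ¬ l ≡ i → ∂-summand (cone i c) J l ≡ + 0
      vanishes-off-i l l≢i = by-membership (lookup J l) refl
        where
        by-membership : ∀ b → lookup J l ≡ b → ∂-summand (cone i c) J l ≡ + 0
        by-membership true l∈J = summand-inside (cone i c) J l l∈J
        by-membership false l∉J = begin
          ∂-summand (cone i c) J l
            ≡⟨ summand-outside (cone i c) J l l∉J ⟩
          sg (countBelow R J l) ℤ.* cone i c (J [ l ]≔ inside)
            ≡⟨ cong (sg (countBelow R J l) ℤ.*_)
                    (cone-outside i c _ (trans (lookup∘update′ (l≢i ∘′ sym) J inside) i∉J)) ⟩
          sg (countBelow R J l) ℤ.* + 0
            ≡⟨ ℤ.*-zeroʳ (sg (countBelow R J l)) ⟩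
          + 0 ∎
      apex-term : ∂-summand (cone i c) J i ≡ c J
      apex-term = begin
        ∂-summand (cone i c) J i
          ≡⟨ summand-outside (cone i c) J i i∉J ⟩
        sg (countBelow R J i) ℤ.* cone i c (J [ i ]≔ inside)
          ≡⟨ cong (sg (countBelow R J i) ℤ.*_) (cone-inside i c _ (lookup∘update i J inside)) ⟩
        sg (countBelow R J i) ℤ.* (sg (countBelow R (J [ i ]≔ inside) i) ℤ.* c ((J [ i ]≔ inside) [ i ]≔ outside))
          ≡⟨ cong₂ (λ n K → sg (countBelow R J i) ℤ.* (sg n ℤ.* c K))
                   (countBelow-update-self J i inside) (update-restore J i i∉J) ⟩
        sg (countBelow R J i) ℤ.* (sg (countBelow R J i) ℤ.* c J)
          ≡⟨ sign-cancel (countBelow R J i) (c J) ⟩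
        c J ∎

    -- Exactly one of i, l precedes the other, so inserting i and l into J ∖ {i}
    -- in the two orders picks up opposite signs.
    off-apex-summands-cancel : ∀ J l → lookup J i ≡ true → ¬ l ≡ i → lookup J l ≡ false →
      ∂-summand (cone i c) J l ℤ.+ sg (countBelow R J i) ℤ.* ∂-summand c (J [ i ]≔ outside) l ≡ + 0
    off-apex-summands-cancel J l i∈J l≢i l∉J = begin
      ∂-summand (cone i c) J l ℤ.+ s ℤ.* ∂-summand c J' l
        ≡⟨ cong₂ (λ u v → u ℤ.+ s ℤ.* v) (summand-outside (cone i c) J l l∉J) (summand-outside c J' l l∉J') ⟩
      sg (countBelow R J l) ℤ.* cone i c (J [ l ]≔ inside) ℤ.+ s ℤ.* (sg (countBelow R J' l) ℤ.* X)
        ≡⟨ cong (λ u → sg (countBelow R J l) ℤ.* u ℤ.+ s ℤ.* (sg (countBelow R J' l) ℤ.* X))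
                (cone-inside i c _ (trans (lookup∘update′ (l≢i ∘′ sym) J inside) i∈J)) ⟩
      sg (countBelow R J l) ℤ.* (sg (countBelow R (J [ l ]≔ inside) i) ℤ.* c ((J [ l ]≔ inside) [ i ]≔ outside))
        ℤ.+ s ℤ.* (sg (countBelow R J' l) ℤ.* X)
        ≡⟨ cong (λ K → sg (countBelow R J l) ℤ.* (sg (countBelow R (J [ l ]≔ inside) i) ℤ.* c K)
                         ℤ.+ s ℤ.* (sg (countBelow R J' l) ℤ.* X))
                ([]≔-commutes J l i l≢i) ⟩
      sg (countBelow R J l) ℤ.* (sg (countBelow R (J [ l ]≔ inside) i) ℤ.* X) ℤ.+ s ℤ.* (sg (countBelow R J' l) ℤ.* X)
        ≡⟨ cong₂ (λ m n → sg m ℤ.* (sg n ℤ.* X) ℤ.+ s ℤ.* (sg (countBelow R J' l) ℤ.* X))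
                 countBelow-J-l (countBelow-insert J l i l∉J) ⟩
      sg (precedes i l ℕ.+ countBelow R J' l) ℤ.* (sg (precedes l i ℕ.+ countBelow R J i) ℤ.* X)
        ℤ.+ s ℤ.* (sg (countBelow R J' l) ℤ.* X)
        ≡⟨ sign-opposite (precedes i l) (precedes l i) (countBelow R J' l) (countBelow R J i) X
                         (precedes-total (l≢i ∘′ sym)) ⟩
      + 0 ∎
      where
      open ≡-Reasoning
      J' = J [ i ]≔ outside
      s = sg (countBelow R J i)
      X = c (J' [ l ]≔ inside)
      l∉J' : lookup J' l ≡ false
      l∉J' = trans (lookup∘update′ l≢i J outside) l∉J
      countBelow-J-l : countBelow R J l ≡ precedes i l ℕ.+ countBelow R J' l
      countBelow-J-l = trans (cong (λ K → countBelow R K l) (sym (update-restore J i i∈J)))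
                             (countBelow-insert J' i l (lookup∘update i J outside))

    ∂-cone-at-apex : ∀ J → lookup J i ≡ true → ∂ R (cone i c) J ℤ.+ cone i (∂ R c) J ≡ c J
    ∂-cone-at-apex J i∈J = begin
      ∂ R (cone i c) J ℤ.+ cone i (∂ R c) J
        ≡⟨ cong (λ v → ∂ R (cone i c) J ℤ.+ v) (cone-inside i (∂ R c) J i∈J) ⟩
      ∂ R (cone i c) J ℤ.+ s ℤ.* ∂ R c J'
        ≡⟨ cong₂ (λ u v → u ℤ.+ s ℤ.* v) (∂≡sum (cone i c) J) (∂≡sum c J') ⟩
      ℤΣ.sum (∂-summand (cone i c) J) ℤ.+ s ℤ.* ℤΣ.sum (∂-summand c J')
        ≡⟨ cong (λ v → ℤΣ.sum (∂-summand (cone i c) J) ℤ.+ v) (*-distribˡ-sum s (∂-summand c J')) ⟩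
      ℤΣ.sum (∂-summand (cone i c) J) ℤ.+ ℤΣ.sum (λ l → s ℤ.* ∂-summand c J' l)
        ≡⟨ ℤΣ.∑-distrib-+ (∂-summand (cone i c) J) (λ l → s ℤ.* ∂-summand c J' l) ⟨
      ℤΣ.sum combined
        ≡⟨ ℤΣ.sum-single combined i cancel-off-i ⟩
      combined i
        ≡⟨ apex-term ⟩
      c J ∎
      where
      open ≡-Reasoning
      J' = J [ i ]≔ outside
      s = sg (countBelow R J i)
      combined : Fin d → ℤ
      combined l = ∂-summand (cone i c) J l ℤ.+ s ℤ.* ∂-summand c J' l
      apex-term : combined i ≡ c J
      apex-term = begin
        combined i
          ≡⟨ cong₂ (λ u v → u ℤ.+ s ℤ.* v)
                   (summand-inside (cone i c) J i i∈J) (summand-outside c J' i (lookup∘update i J outside)) ⟩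
        + 0 ℤ.+ s ℤ.* (sg (countBelow R J' i) ℤ.* c (J' [ i ]≔ inside))
          ≡⟨ ℤ.+-identityˡ _ ⟩
        s ℤ.* (sg (countBelow R J' i) ℤ.* c (J' [ i ]≔ inside))
          ≡⟨ cong₂ (λ n K → s ℤ.* (sg n ℤ.* c K)) (countBelow-update-self J i outside) (update-restore J i i∈J) ⟩
        s ℤ.* (s ℤ.* c J)
          ≡⟨ sign-cancel (countBelow R J i) (c J) ⟩
        c J ∎
      cancel-off-i : ∀ l → ¬ l ≡ i → combined l ≡ + 0
      cancel-off-i l l≢i = by-membership (lookup J l) refl
        where
        by-membership : ∀ b → lookup J l ≡ b → combined l ≡ + 0
        by-membership false l∉J = off-apex-summands-cancel J l i∈J l≢i l∉J
        by-membership true l∈J =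
          trans (cong₂ (λ u v → u ℤ.+ s ℤ.* v) (summand-inside (cone i c) J l l∈J)
                       (summand-inside c J' l (trans (lookup∘update′ l≢i J outside) l∈J)))
                (trans (ℤ.+-identityˡ _) (ℤ.*-zeroʳ s))

  cone-homotopy : ∀ i c J → ∂ R (cone i c) J ℤ.+ cone i (∂ R c) J ≡ c J
  cone-homotopy i c J = by-membership (lookup J i) refl
    where
    by-membership : ∀ b → lookup J i ≡ b → ∂ R (cone i c) J ℤ.+ cone i (∂ R c) J ≡ c J
    by-membership true i∈J = ∂-cone-at-apex i c J i∈J
    by-membership false i∉J = begin
      ∂ R (cone i c) J ℤ.+ cone i (∂ R c) J  ≡⟨ cong (λ v → ∂ R (cone i c) J ℤ.+ v) (cone-outside i (∂ R c) J i∉J) ⟩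
      ∂ R (cone i c) J ℤ.+ + 0               ≡⟨ ℤ.+-identityʳ _ ⟩
      ∂ R (cone i c) J                       ≡⟨ ∂-cone-off-apex i c J i∉J ⟩
      c J                                    ∎
      where open ≡-Reasoning

  ∣∣-remove : ∀ {n} (J : Subset n) i → lookup J i ≡ true → ∣ J ∣ ≡ suc ∣ J [ i ]≔ outside ∣
  ∣∣-remove (true ∷ J) Fin.zero _ = refl
  ∣∣-remove (true ∷ J) (Fin.suc i) i∈J = cong suc (∣∣-remove J i i∈J)
  ∣∣-remove (false ∷ J) (Fin.suc i) i∈J = ∣∣-remove J i i∈J

  module _ {V : List (Point R {d})} {p : Point R {d}} (i : Fin d)
           (apex : ∀ J → InΔ R V p J → InΔ R V p (J [ i ]≔ inside)) where

    cone-chain : ∀ k c → Chain R V p k c → Chain R V p (suc k) (cone i c)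
    cone-chain k c chain K coneK≢0 = by-membership (lookup K i) refl
      where
      by-membership : ∀ b → lookup K i ≡ b → InΔ R V p K × ∣ K ∣ ≡ suc k
      by-membership false i∉K = ⊥-elim (coneK≢0 (cone-outside i c K i∉K))
      by-membership true i∈K =
        subst (InΔ R V p) (update-restore K i i∈K) (apex K' K'∈Δ) ,
        trans (∣∣-remove K i i∈K) (cong suc ∣K'∣≡k)
        where
        K' = K [ i ]≔ outside
        cK'≢0 : ¬ c K' ≡ + 0
        cK'≢0 cK'≡0 = coneK≢0 (trans (cone-inside i c K i∈K)
                                 (trans (cong (sg (countBelow R K i) ℤ.*_) cK'≡0) (ℤ.*-zeroʳ (sg (countBelow R K i)))))
        K'∈Δ = proj₁ (chain K' cK'≢0)
        ∣K'∣≡k = proj₂ (chain K' cK'≢0)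

    cone-cycle⇒boundary : ∀ k c → Cycle R V p k c → Boundary R V p k c
    cone-cycle⇒boundary k c (chain , closed) = cone i c , cone-chain k c chain , ∂-cone≡c
      where
      cone-∂-vanishes : ∀ J → ∣ J ∣ ≡ k → cone i (∂ R c) J ≡ + 0
      cone-∂-vanishes J ∣J∣≡k = by-membership (lookup J i) refl
        where
        by-membership : ∀ b → lookup J i ≡ b → cone i (∂ R c) J ≡ + 0
        by-membership false i∉J = cone-outside i (∂ R c) J i∉J
        by-membership true i∈J =
          trans (cone-inside i (∂ R c) J i∈J)
                (trans (cong (sg (countBelow R J i) ℤ.*_) (closed _ (trans (sym (∣∣-remove J i i∈J)) ∣J∣≡k)))
                       (ℤ.*-zeroʳ (sg (countBelow R J i))))
      ∂-cone≡c : ∀ J → ∣ J ∣ ≡ k → ∂ R (cone i c) J ≡ c J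
      ∂-cone≡c J ∣J∣≡k = begin
        ∂ R (cone i c) J                        ≡⟨ ℤ.+-identityʳ _ ⟨
        ∂ R (cone i c) J ℤ.+ + 0                ≡⟨ cong (λ v → ∂ R (cone i c) J ℤ.+ v) (cone-∂-vanishes J ∣J∣≡k) ⟨
        ∂ R (cone i c) J ℤ.+ cone i (∂ R c) J   ≡⟨ cone-homotopy i c J ⟩
        c J                                     ∎
        where open ≡-Reasoning

module Staircase (R : CompleteOrderedField) {d : ℕ} (V : List (Point R {d})) (p : Point R {d}) where
  open CompleteOrderedField R
  open OrderedFieldProperties R
  open IsStrictTotalOrder isStrictTotalOrder using (_<?_) renaming (_≟_ to _≟ᴿ_)

  ≼p? : ∀ w → Dec (_≼_ R w p)
  ≼p? w = Fin.all? λ k → (w k <? p k) ⊎-dec (w k ≟ᴿ p k)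

  Blocked : (Fin d → Set) → Set
  Blocked A = ∃[ w ] (w ∈ V × _≼_ R w p × (∀ k → w k < p k ⊎ A k))

  blocked-mono : ∀ {A B : Fin d → Set} → (∀ k → A k → B k) → Blocked A → Blocked B
  blocked-mono A⇒B (w , w∈V , w≼p , below) = w , w∈V , w≼p , λ k → Sum.map₂ (A⇒B k) (below k)

  blocked? : ∀ {A : Fin d → Set} → (∀ k → Dec (A k)) → Dec (Blocked A)
  blocked? A? = map′ find (λ (w , w∈V , below) → lose w∈V below)
    (any? (λ w → ≼p? w ×-dec Fin.all? λ k → (w k <? p k) ⊎-dec A? k) V)

  -- shift R p I δ is definitionally raise (lookup I) δ.
  raise : (Fin d → Bool) → Carrier → Point R {d}
  raise b δ k = if b k then p k + δ else p k

  module _ (b : Fin d → Bool) {δ : Carrier} (0<δ : 0# < δ) where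

    p≼raise : _≼_ R p (raise b δ)
    p≼raise k with b k
    ... | true = inj₁ (x<x+ε (p k) 0<δ)
    ... | false = ≤-refl

    raise≤p+δ : ∀ k → raise b δ k ≤ p k + δ
    raise≤p+δ k with b k
    ... | true = ≤-refl
    ... | false = inj₁ (x<x+ε (p k) 0<δ)

    raise-raises : ∀ k → T (b k) → p k < raise b δ k
    raise-raises k _ with b k
    ... | true = x<x+ε (p k) 0<δ

  raise-fixes : ∀ b {δ} k → T (not (b k)) → raise b δ k ≡ p k
  raise-fixes b k _ with b k
  ... | false = refl

  raised⇒true : ∀ b {δ} k → p k < raise b δ k → T (b k)
  raised⇒true b k p<raise with b k
  ... | true = _
  ... | false = ⊥-elim (<-irrefl p<raise)

  blocked⇒dominated : ∀ {A q} → Blocked A → _≼_ R p q → (∀ k → A k → p k < q k) →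
                      ∃[ w ] (w ∈ V × _⊳_ R q w)
  blocked⇒dominated (w , w∈V , w≼p , below) p≼q A⇒< =
    w , w∈V , λ k → [ (λ wₖ<pₖ → <-≤-trans wₖ<pₖ (p≼q k)) , (λ Aₖ → ≤-<-trans (w≼p k) (A⇒< k Aₖ)) ]′
                      (below k)

  Separating : Carrier → Set
  Separating δ = ∀ w → w ∈ V → ∀ k → p k < w k → p k + δ ≤ w k

  eventually-separating : Eventually Separating
  eventually-separating = eventually-∀∈ V λ w → eventually-∀ λ k → eventually-below-gap (p k) (w k)

  InS-nearby : ∀ {δ q} → InS R V p → Separating δ → _≼_ R p q → (∀ k → q k ≤ p k + δ) →
               ¬ Blocked (λ k → p k < q k) → InS R V q
  InS-nearby {q = q} ((v , v∈V , v≼p) , _) sep p≼q q≤p+δ unblocked =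
    (v , v∈V , λ k → ≤-trans (v≼p k) (p≼q k)) , q-undominated
    where
    q-undominated : ∀ w → w ∈ V → ¬ _⊳_ R q w
    q-undominated w w∈V q⊳w = unblocked (w , w∈V , w≼p , below)
      where
      w≼p : _≼_ R w p
      w≼p k = ≮⇒≥ λ pₖ<wₖ → <⇒≱ (q⊳w k) (≤-trans (q≤p+δ k) (sep w w∈V k pₖ<wₖ))
      below : ∀ k → w k < p k ⊎ p k < q k
      below k with p≼q k
      ... | inj₁ pₖ<qₖ = inj₂ pₖ<qₖ
      ... | inj₂ pₖ≡qₖ = inj₁ (subst (w k <_) (sym pₖ≡qₖ) (q⊳w k))

  InΔ⇒unblocked : ∀ I → InΔ R V p I → ¬ Blocked (λ k → T (lookup I k))
  InΔ⇒unblocked I (ε , 0<ε , _ , undominated) blocked =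
    let w , w∈V , shift⊳w = blocked⇒dominated blocked (p≼raise (lookup I) 0<ε) (raise-raises (lookup I) 0<ε)
    in undominated w w∈V shift⊳w

  unblocked⇒InΔ : ∀ I → InS R V p → ¬ Blocked (λ k → T (lookup I k)) → InΔ R V p I
  unblocked⇒InΔ I p∈S unblocked =
    let δ , 0<δ , sep = eventually-witness eventually-separating
    in δ , 0<δ , InS-nearby p∈S sep (p≼raise (lookup I) 0<δ) (raise≤p+δ (lookup I) 0<δ)
         (unblocked ∘ blocked-mono (raised⇒true (lookup I)))

  Tight : Point R {d} → Fin d → Fin d → Set
  Tight w i k = ¬ k ≡ i × w k ≡ p k

  tight? : ∀ w i k → Dec (Tight w i k)
  tight? w i k = ¬? (k Fin.≟ i) ×-dec (w k ≟ᴿ p k)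

  FlatWitness : Fin d → Point R {d} → Set
  FlatWitness i w = _≼_ R w p × w i ≡ p i × ¬ Blocked (Tight w i)

  flatWitness? : ∀ i w → Dec (FlatWitness i w)
  flatWitness? i w = ≼p? w ×-dec (w i ≟ᴿ p i) ×-dec ¬? (blocked? (tight? w i))

  module _ {w i} (p∈S : InS R V p) (w≼p : _≼_ R w p) (wᵢ≡pᵢ : w i ≡ p i)
           (tight-unblocked : ¬ Blocked (Tight w i)) where

    tightAt : Fin d → Bool
    tightAt k = isYes (tight? w i k)

    raise-tight∈U : ∀ {δ} → 0# < δ → Separating δ → InU R V i w (raise tightAt δ)
    raise-tight∈U {δ} 0<δ sep =
      InS-nearby p∈S sep (p≼raise tightAt 0<δ) (raise≤p+δ tightAt 0<δ) (tight-unblocked ∘ blocked-mono raised⇒tight) ,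
      qᵢ≡wᵢ , w<q
      where
      raised⇒tight : ∀ k → p k < raise tightAt δ k → Tight w i k
      raised⇒tight k pₖ<qₖ = toWitness (raised⇒true tightAt k pₖ<qₖ)
      qᵢ≡wᵢ : raise tightAt δ i ≡ w i
      qᵢ≡wᵢ = trans (raise-fixes tightAt i (fromWitnessFalse (λ (i≢i , _) → i≢i refl))) (sym wᵢ≡pᵢ)
      w<q : ∀ j → ¬ j ≡ i → w j < raise tightAt δ j
      w<q j j≢i with w≼p j
      ... | inj₁ wⱼ<pⱼ = <-≤-trans wⱼ<pⱼ (p≼raise tightAt 0<δ j)
      ... | inj₂ wⱼ≡pⱼ =
        subst (_< raise tightAt δ j) (sym wⱼ≡pⱼ) (raise-raises tightAt 0<δ j (fromWitness (j≢i , wⱼ≡pⱼ)))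

    witness⇒InFlat : InFlat R V i w p
    witness⇒InFlat ε 0<ε =
      let δ , 0<δ , sep , δ<ε = eventually-witness (eventually-× eventually-separating (eventually-< 0<ε))
      in raise tightAt δ , (w , Star.ε , raise-tight∈U 0<δ sep) ,
         λ k → <-≤-trans (x-ε<x (p k) 0<ε) (p≼raise tightAt 0<δ k) ,
               ≤-<-trans (raise≤p+δ tightAt 0<δ k) (+-monoʳ-< (p k) δ<ε)

  no-flat-witness⇒unblocked-cone : ∀ {i} I → (∀ w → w ∈ V → ¬ FlatWitness i w) →
    ¬ Blocked (λ k → T (lookup I k)) → ¬ Blocked (λ k → T (lookup (I [ i ]≔ inside) k))
  no-flat-witness⇒unblocked-cone {i} I no-witness unblocked (w , w∈V , w≼p , below) with w≼p i
  ... | inj₁ wᵢ<pᵢ = unblocked (w , w∈V , w≼p , below-I)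
    where
    below-I : ∀ k → w k < p k ⊎ T (lookup I k)
    below-I k with k Fin.≟ i | below k
    ... | yes refl | _ = inj₁ wᵢ<pᵢ
    ... | no _ | inj₁ wₖ<pₖ = inj₁ wₖ<pₖ
    ... | no k≢i | inj₂ k∈I+i = inj₂ (subst T (lookup∘update′ k≢i I inside) k∈I+i)
  ... | inj₂ wᵢ≡pᵢ = no-witness w w∈V (w≼p , wᵢ≡pᵢ , unblocked ∘ blocked-mono tight⇒∈I)
    where
    tight⇒∈I : ∀ k → Tight w i k → T (lookup I k)
    tight⇒∈I k (k≢i , wₖ≡pₖ) with below k
    ... | inj₁ wₖ<pₖ = ⊥-elim (<-irrefl (subst (_< p k) wₖ≡pₖ wₖ<pₖ))
    ... | inj₂ k∈I+i = subst T (lookup∘update′ k≢i I inside) k∈I+i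

  no-flat-witness⇒apex : ∀ {i} → InS R V p → (∀ w → w ∈ V → ¬ FlatWitness i w) →
    ∀ J → InΔ R V p J → InΔ R V p (J [ i ]≔ inside)
  no-flat-witness⇒apex p∈S no-witness J J∈Δ =
    unblocked⇒InΔ (J [ _ ]≔ inside) p∈S (no-flat-witness⇒unblocked-cone J no-witness (InΔ⇒unblocked J J∈Δ))

mainTheorem9 : (R : CompleteOrderedField) (d : ℕ) (V : List (Point R {d})) (p : Point R {d}) →
    Antichain R V → InS R V p → SyzygyPoint R V p → Characteristic R V p
mainTheorem9 R d V p _ p∈S (k , c , cycle , not-boundary) = p∈S , flat-in-direction
  where
  open Staircase R V p
  flat-in-direction : ∀ i → ∃[ v ] (v ∈ V × InFlat R V i v p)
  flat-in-direction i with any? (flatWitness? i) V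
  ... | yes witness =
    let w , w∈V , w≼p , wᵢ≡pᵢ , tight-unblocked = find witness
    in w , w∈V , witness⇒InFlat p∈S w≼p wᵢ≡pᵢ tight-unblocked
  ... | no no-witness = ⊥-elim (not-boundary (SimplicialCone.cone-cycle⇒boundary R i apex k c cycle))
    where
    apex : ∀ J → InΔ R V p J → InΔ R V p (J [ i ]≔ inside)
    apex = no-flat-witness⇒apex p∈S λ w w∈V witness → no-witness (lose w∈V witness)
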